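{- Let $BH_2$ be the $2$-dimensional balanced hypercube, let $v$ be a faulty vertex and $e$ a faulty edge of $BH_2$. Then there exists a fault-free cycle of length $14$ in $BH_2$.
   Context: The $2$-dimensional balanced hypercube $BH_2$ has vertex set $\{(a_0,a_1): a_0,a_1\in\{0,1,2,3\}\}$, and each vertex $(a_0,a_1)$ is adjacent exactly to the four vertices $((a_0\pm1)\bmod 4, a_1)$ and $((a_0\pm1)\bmod 4, (a_1+(-1)^{a_0})\bmod 4)$. A cycle is fault-free if it contains neither the faulty vertex $v$ nor the faulty edge $e$. The length of a cycle is its number of edges. -}

module Defs where

open import Data.Fin using (Fin; zero; suc)
open import Data.Nat using (ℕ)
open import Data.Product using (_×_; _,_; Σ; proj₁; proj₂)
open import Data.Sum using (_⊎_)
open import Data.Vec.Functional using (Vector)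
open import Function.Definitions using (Injective)
open import Relation.Binary.PropositionalEquality using (_≡_)
open import Relation.Nullary using (¬_; yes; no)
import Data.Fin
import Data.Nat

Z4 : Set
Z4 = Fin 4

inc : Z4 → Z4
inc zero = suc zero
inc (suc zero) = suc (suc zero)
inc (suc (suc zero)) = suc (suc (suc zero))
inc (suc (suc (suc zero))) = zero

dec : Z4 → Z4
dec zero = suc (suc (suc zero))
dec (suc zero) = zero
dec (suc (suc zero)) = suc zero
dec (suc (suc (suc zero))) = suc (suc zero)

-- a1 + (-1)^a0 mod 4 : +1 if a0 even, -1 if a0 odd
shift : Z4 → Z4 → Z4
shift zero a1 = inc a1
shift (suc zero) a1 = dec a1
shift (suc (suc zero)) a1 = inc a1
shift (suc (suc (suc zero))) a1 = dec a1

Vertex : Set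
Vertex = Z4 × Z4

data Adj : Vertex → Vertex → Set where
  inc-same  : ∀ a0 a1 → Adj (a0 , a1) (inc a0 , a1)
  dec-same  : ∀ a0 a1 → Adj (a0 , a1) (dec a0 , a1)
  inc-shift : ∀ a0 a1 → Adj (a0 , a1) (inc a0 , shift a0 a1)
  dec-shift : ∀ a0 a1 → Adj (a0 , a1) (dec a0 , shift a0 a1)

-- an edge of BH_2: an (ordered representative of an) adjacent pair
Edge : Set
Edge = Σ (Vertex × Vertex) (λ p → Adj (proj₁ p) (proj₂ p))

-- cyclic successor on indices Fin k: i ↦ i+1, with the last index wrapping to 0
next : ∀ {k} → Fin k → Fin k
next {ℕ.suc k} i with Data.Fin.toℕ i Data.Nat.<? k
... | yes p = Data.Fin.fromℕ< {ℕ.suc (Data.Fin.toℕ i)} (Data.Nat.s≤s p)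
... | no _  = zero

record Cycle (k : ℕ) : Set where
  field
    vert     : Vector Vertex k
    distinct : Injective _≡_ _≡_ vert
    adjacent : ∀ i → Adj (vert i) (vert (next i))

AvoidsVertex : ∀ {k} → Cycle k → Vertex → Set
AvoidsVertex {k} C v = ∀ i → ¬ (Cycle.vert C i ≡ v)

AvoidsEdge : ∀ {k} → Cycle k → Vertex → Vertex → Set
AvoidsEdge {k} C x y = ∀ i → ¬ ((Cycle.vert C i ≡ x × Cycle.vert C (next i) ≡ y)
                              ⊎ (Cycle.vert C i ≡ y × Cycle.vert C (next i) ≡ x))

-- BH₂ is vertex-transitive: shifting the second coordinate, and the map
-- (a₀ , a₁) ↦ (a₀ + 1 , −a₁), are automorphisms, and together they move the
-- origin to any vertex.  Hence the faulty vertex may be assumed to be the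
-- origin.  Three 14-cycles avoiding the origin, with no edge common to all
-- three, then avoid every possible faulty edge.
module Submission where

open import Data.Fin using (Fin; toℕ)
open import Data.Fin.Patterns using (0F; 1F; 2F; 3F)
open import Data.Fin.Properties using (all?; any?) renaming (_≟_ to _≟ᶠ_)
open import Data.Nat using (ℕ; zero; suc)
open import Data.Product using (Σ; ∃-syntax; _×_; _,_; proj₁; proj₂)
import Data.Product as Product
open import Data.Product.Properties using (≡-dec)
import Data.Sum as Sum
open import Data.Vec using (Vec; lookup; []; _∷_)
open import Function.Base using (_∘_)
open import Function.Definitions using (Injective)
open import Relation.Binary.Definitions using (DecidableEquality)
open import Relation.Binary.PropositionalEquality
  using (_≡_; refl; sym; trans; cong; cong₂; subst)
open import Relation.Nullary using (Dec; ¬?)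
open import Relation.Nullary.Decidable
  using (True; toWitness; map′; _×-dec_; _⊎-dec_; _→-dec_)
open import Defs

neg : Z4 → Z4
neg 0F = 0F
neg 1F = 3F
neg 2F = 2F
neg 3F = 1F

dec-inc : ∀ a → dec (inc a) ≡ a
dec-inc 0F = refl
dec-inc 1F = refl
dec-inc 2F = refl
dec-inc 3F = refl

inc-dec-comm : ∀ a → inc (dec a) ≡ dec (inc a)
inc-dec-comm 0F = refl
inc-dec-comm 1F = refl
inc-dec-comm 2F = refl
inc-dec-comm 3F = refl

neg-involutive : ∀ a → neg (neg a) ≡ a
neg-involutive 0F = refl
neg-involutive 1F = refl
neg-involutive 2F = refl
neg-involutive 3F = refl

neg-inc : ∀ a → neg (inc a) ≡ dec (neg a)
neg-inc 0F = refl
neg-inc 1F = refl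
neg-inc 2F = refl
neg-inc 3F = refl

neg-dec : ∀ a → neg (dec a) ≡ inc (neg a)
neg-dec 0F = refl
neg-dec 1F = refl
neg-dec 2F = refl
neg-dec 3F = refl

shift-inc : ∀ a₀ a₁ → shift a₀ (inc a₁) ≡ inc (shift a₀ a₁)
shift-inc 0F a₁ = refl
shift-inc 1F a₁ = sym (inc-dec-comm a₁)
shift-inc 2F a₁ = refl
shift-inc 3F a₁ = sym (inc-dec-comm a₁)

shift-dec : ∀ a₀ a₁ → shift a₀ (dec a₁) ≡ dec (shift a₀ a₁)
shift-dec 0F a₁ = inc-dec-comm a₁
shift-dec 1F a₁ = refl
shift-dec 2F a₁ = inc-dec-comm a₁
shift-dec 3F a₁ = refl

shift-inc-neg : ∀ a₀ a₁ → shift (inc a₀) (neg a₁) ≡ neg (shift a₀ a₁)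
shift-inc-neg 0F a₁ = sym (neg-inc a₁)
shift-inc-neg 1F a₁ = sym (neg-dec a₁)
shift-inc-neg 2F a₁ = sym (neg-inc a₁)
shift-inc-neg 3F a₁ = sym (neg-dec a₁)

shift-dec-neg : ∀ a₀ a₁ → shift (dec a₀) (neg a₁) ≡ neg (shift a₀ a₁)
shift-dec-neg 0F a₁ = sym (neg-inc a₁)
shift-dec-neg 1F a₁ = sym (neg-dec a₁)
shift-dec-neg 2F a₁ = sym (neg-inc a₁)
shift-dec-neg 3F a₁ = sym (neg-dec a₁)

retarget : ∀ {x a₀ a₁ b₀ b₁} → a₀ ≡ b₀ → a₁ ≡ b₁ → Adj x (a₀ , a₁) → Adj x (b₀ , b₁)
retarget refl refl x~a = x~a

-- Only a left inverse is required: an injective map of the finite vertex set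
-- is a bijection anyway.
record Automorphism : Set where
  field
    to       : Vertex → Vertex
    from     : Vertex → Vertex
    from-to  : ∀ x → from (to x) ≡ x
    to-adj   : ∀ {x y} → Adj x y → Adj (to x) (to y)
    from-adj : ∀ {x y} → Adj x y → Adj (from x) (from y)

  to≡⇒≡from : ∀ {x y} → to x ≡ y → x ≡ from y
  to≡⇒≡from {x} eq = trans (sym (from-to x)) (cong from eq)

  to-injective : Injective _≡_ _≡_ to
  to-injective {y = y} eq = trans (to≡⇒≡from eq) (from-to y)

open Automorphism

idᴬ : Automorphism
idᴬ = record
  { to       = λ x → x
  ; from     = λ x → x
  ; from-to  = λ _ → refl
  ; to-adj   = λ x~y → x~y
  ; from-adj = λ x~y → x~y
  }

_∘ᴬ_ : Automorphism → Automorphism → Automorphism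
f ∘ᴬ g = record
  { to       = to f ∘ to g
  ; from     = from g ∘ from f
  ; from-to  = λ x → trans (cong (from g) (from-to f (to g x))) (from-to g x)
  ; to-adj   = λ x~y → to-adj f (to-adj g x~y)
  ; from-adj = λ x~y → from-adj g (from-adj f x~y)
  }

_^ᴬ_ : Automorphism → ℕ → Automorphism
f ^ᴬ zero  = idᴬ
f ^ᴬ suc n = f ∘ᴬ (f ^ᴬ n)

translate : Automorphism
translate = record
  { to       = λ (a₀ , a₁) → a₀ , inc a₁
  ; from     = λ (a₀ , a₁) → a₀ , dec a₁
  ; from-to  = λ (a₀ , a₁) → cong (a₀ ,_) (dec-inc a₁)
  ; to-adj   = to-adj′
  ; from-adj = from-adj′
  }
  where
  to-adj′ : ∀ {x y} → Adj x y → Adj (proj₁ x , inc (proj₂ x)) (proj₁ y , inc (proj₂ y))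
  to-adj′ (inc-same a₀ a₁)  = inc-same a₀ (inc a₁)
  to-adj′ (dec-same a₀ a₁)  = dec-same a₀ (inc a₁)
  to-adj′ (inc-shift a₀ a₁) = retarget refl (shift-inc a₀ a₁) (inc-shift a₀ (inc a₁))
  to-adj′ (dec-shift a₀ a₁) = retarget refl (shift-inc a₀ a₁) (dec-shift a₀ (inc a₁))

  from-adj′ : ∀ {x y} → Adj x y → Adj (proj₁ x , dec (proj₂ x)) (proj₁ y , dec (proj₂ y))
  from-adj′ (inc-same a₀ a₁)  = inc-same a₀ (dec a₁)
  from-adj′ (dec-same a₀ a₁)  = dec-same a₀ (dec a₁)
  from-adj′ (inc-shift a₀ a₁) = retarget refl (shift-dec a₀ a₁) (inc-shift a₀ (dec a₁))
  from-adj′ (dec-shift a₀ a₁) = retarget refl (shift-dec a₀ a₁) (dec-shift a₀ (dec a₁))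

-- Negating a₁ compensates for the parity change of a₀, which flips the sign
-- in the shifted edges.
rotate : Automorphism
rotate = record
  { to       = λ (a₀ , a₁) → inc a₀ , neg a₁
  ; from     = λ (a₀ , a₁) → dec a₀ , neg a₁
  ; from-to  = λ (a₀ , a₁) → cong₂ _,_ (dec-inc a₀) (neg-involutive a₁)
  ; to-adj   = to-adj′
  ; from-adj = from-adj′
  }
  where
  to-adj′ : ∀ {x y} → Adj x y → Adj (inc (proj₁ x) , neg (proj₂ x)) (inc (proj₁ y) , neg (proj₂ y))
  to-adj′ (inc-same a₀ a₁)  = inc-same (inc a₀) (neg a₁)
  to-adj′ (dec-same a₀ a₁)  = retarget (sym (inc-dec-comm a₀)) refl (dec-same (inc a₀) (neg a₁))
  to-adj′ (inc-shift a₀ a₁) = retarget refl (shift-inc-neg a₀ a₁) (inc-shift (inc a₀) (neg a₁))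
  to-adj′ (dec-shift a₀ a₁) =
    retarget (sym (inc-dec-comm a₀)) (shift-inc-neg a₀ a₁) (dec-shift (inc a₀) (neg a₁))

  from-adj′ : ∀ {x y} → Adj x y → Adj (dec (proj₁ x) , neg (proj₂ x)) (dec (proj₁ y) , neg (proj₂ y))
  from-adj′ (inc-same a₀ a₁)  = retarget (inc-dec-comm a₀) refl (inc-same (dec a₀) (neg a₁))
  from-adj′ (dec-same a₀ a₁)  = dec-same (dec a₀) (neg a₁)
  from-adj′ (inc-shift a₀ a₁) =
    retarget (inc-dec-comm a₀) (shift-dec-neg a₀ a₁) (inc-shift (dec a₀) (neg a₁))
  from-adj′ (dec-shift a₀ a₁) = retarget refl (shift-dec-neg a₀ a₁) (dec-shift (dec a₀) (neg a₁))

origin : Vertex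
origin = 0F , 0F

reach : Vertex → Automorphism
reach (a₀ , a₁) = (translate ^ᴬ toℕ a₁) ∘ᴬ (rotate ^ᴬ toℕ a₀)

reach-origin : ∀ v → to (reach v) origin ≡ v
reach-origin (a₀ , a₁) =
  trans (cong (to (translate ^ᴬ toℕ a₁)) (rotate-origin a₀)) (translate-axis a₀ a₁)
  where
  rotate-origin : ∀ a₀ → to (rotate ^ᴬ toℕ a₀) origin ≡ (a₀ , 0F)
  rotate-origin 0F = refl
  rotate-origin 1F = refl
  rotate-origin 2F = refl
  rotate-origin 3F = refl

  translate-axis : ∀ a₀ a₁ → to (translate ^ᴬ toℕ a₁) (a₀ , 0F) ≡ (a₀ , a₁)
  translate-axis a₀ 0F = refl
  translate-axis a₀ 1F = refl
  translate-axis a₀ 2F = refl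
  translate-axis a₀ 3F = refl

FaultFreeCycle : ℕ → Vertex → Vertex → Vertex → Set
FaultFreeCycle k v x y = Σ (Cycle k) (λ C → AvoidsVertex C v × AvoidsEdge C x y)

mapCycle : ∀ {k} → Automorphism → Cycle k → Cycle k
mapCycle f C = record
  { vert     = to f ∘ Cycle.vert C
  ; distinct = Cycle.distinct C ∘ to-injective f
  ; adjacent = to-adj f ∘ Cycle.adjacent C
  }

transport : ∀ {k u x y} (f : Automorphism) →
            FaultFreeCycle k u (from f x) (from f y) → FaultFreeCycle k (to f u) x y
transport {x = x} {y} f (C , avoids-u , avoids-xy) =
  mapCycle f C , (λ i → avoids-u i ∘ to-injective f) , (λ i → avoids-xy i ∘ pull-back)
  where
  pull-back : ∀ {a b} →
              (to f a ≡ x × to f b ≡ y) Sum.⊎ (to f a ≡ y × to f b ≡ x) →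
              (a ≡ from f x × b ≡ from f y) Sum.⊎ (a ≡ from f y × b ≡ from f x)
  pull-back = Sum.map (Product.map (to≡⇒≡from f) (to≡⇒≡from f))
                      (Product.map (to≡⇒≡from f) (to≡⇒≡from f))

neighbour : Fin 4 → Vertex → Vertex
neighbour 0F (a₀ , a₁) = inc a₀ , a₁
neighbour 1F (a₀ , a₁) = dec a₀ , a₁
neighbour 2F (a₀ , a₁) = inc a₀ , shift a₀ a₁
neighbour 3F (a₀ , a₁) = dec a₀ , shift a₀ a₁

neighbour-adj : ∀ d x → Adj x (neighbour d x)
neighbour-adj 0F (a₀ , a₁) = inc-same a₀ a₁
neighbour-adj 1F (a₀ , a₁) = dec-same a₀ a₁
neighbour-adj 2F (a₀ , a₁) = inc-shift a₀ a₁
neighbour-adj 3F (a₀ , a₁) = dec-shift a₀ a₁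

adj⇒neighbour : ∀ {x y} → Adj x y → ∃[ d ] y ≡ neighbour d x
adj⇒neighbour (inc-same a₀ a₁)  = 0F , refl
adj⇒neighbour (dec-same a₀ a₁)  = 1F , refl
adj⇒neighbour (inc-shift a₀ a₁) = 2F , refl
adj⇒neighbour (dec-shift a₀ a₁) = 3F , refl

_≟ᵛ_ : DecidableEquality Vertex
_≟ᵛ_ = ≡-dec _≟ᶠ_ _≟ᶠ_

all-vertices? : ∀ {P : Vertex → Set} → (∀ v → Dec (P v)) → Dec (∀ v → P v)
all-vertices? P? =
  map′ (λ h (a₀ , a₁) → h a₀ a₁) (λ h a₀ a₁ → h (a₀ , a₁)) (all? λ a₀ → all? λ a₁ → P? (a₀ , a₁))

distinct? : ∀ {k} (vs : Vec Vertex k) → Dec (∀ i j → lookup vs i ≡ lookup vs j → i ≡ j)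
distinct? vs = all? λ i → all? λ j → (lookup vs i ≟ᵛ lookup vs j) →-dec (i ≟ᶠ j)

closed-walk? : ∀ {k} (vs : Vec Vertex k) → Dec (∀ i → ∃[ d ] lookup vs (next i) ≡ neighbour d (lookup vs i))
closed-walk? vs = all? λ i → any? λ d → lookup vs (next i) ≟ᵛ neighbour d (lookup vs i)

cycle : ∀ {k} (vs : Vec Vertex k) → {True (distinct? vs)} → {True (closed-walk? vs)} → Cycle k
cycle vs {distinct} {closed} = record
  { vert     = lookup vs
  ; distinct = λ {i} {j} → toWitness distinct i j
  ; adjacent = λ i → let d , eq = toWitness closed i in subst (Adj _) (sym eq) (neighbour-adj d _)
  }

avoidsVertex? : ∀ {k} (C : Cycle k) v → Dec (AvoidsVertex C v)
avoidsVertex? C v = all? λ i → ¬? (Cycle.vert C i ≟ᵛ v)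

avoidsEdge? : ∀ {k} (C : Cycle k) x y → Dec (AvoidsEdge C x y)
avoidsEdge? C x y = all? λ i → ¬? (((vert i ≟ᵛ x) ×-dec (vert (next i) ≟ᵛ y)) ⊎-dec
                                   ((vert i ≟ᵛ y) ×-dec (vert (next i) ≟ᵛ x)))
  where open Cycle C

originAvoiding : Fin 3 → Cycle 14
originAvoiding 0F = cycle ((0F , 1F) ∷ (1F , 1F) ∷ (2F , 1F) ∷ (3F , 1F) ∷ (2F , 0F) ∷ (1F , 0F) ∷ (0F , 3F) ∷
                           (3F , 0F) ∷ (2F , 3F) ∷ (1F , 3F) ∷ (2F , 2F) ∷ (1F , 2F) ∷ (0F , 2F) ∷ (3F , 2F) ∷ [])
originAvoiding 1F = cycle ((0F , 1F) ∷ (1F , 2F) ∷ (2F , 1F) ∷ (3F , 2F) ∷ (2F , 2F) ∷ (1F , 3F) ∷ (0F , 2F) ∷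
                           (3F , 3F) ∷ (0F , 3F) ∷ (1F , 0F) ∷ (2F , 3F) ∷ (3F , 0F) ∷ (2F , 0F) ∷ (1F , 1F) ∷ [])
originAvoiding 2F = cycle ((0F , 1F) ∷ (3F , 1F) ∷ (2F , 1F) ∷ (1F , 1F) ∷ (2F , 0F) ∷ (3F , 0F) ∷ (0F , 3F) ∷
                           (1F , 3F) ∷ (2F , 3F) ∷ (3F , 3F) ∷ (0F , 2F) ∷ (1F , 2F) ∷ (2F , 2F) ∷ (3F , 2F) ∷ [])

originAvoiding-avoids-origin : ∀ i → AvoidsVertex (originAvoiding i) origin
originAvoiding-avoids-origin = toWitness {a? = all? λ i → avoidsVertex? (originAvoiding i) origin} _

originAvoiding-avoid-every-edge : ∀ d x → ∃[ i ] AvoidsEdge (originAvoiding i) x (neighbour d x)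
originAvoiding-avoid-every-edge =
  toWitness {a? = all? λ d → all-vertices? λ x → any? λ i → avoidsEdge? (originAvoiding i) x (neighbour d x)} _

-- Projections, not a pattern match: destructuring the witness makes Agda
-- normalise the whole decision procedure above and exhaust memory.
fault-free-along : ∀ d x → FaultFreeCycle 14 origin x (neighbour d x)
fault-free-along d x =
  originAvoiding (proj₁ avoided) , originAvoiding-avoids-origin (proj₁ avoided) , proj₂ avoided
  where
  avoided : ∃[ i ] AvoidsEdge (originAvoiding i) x (neighbour d x)
  avoided = originAvoiding-avoid-every-edge d x

fault-free-at-origin : ∀ {x y} → Adj x y → FaultFreeCycle 14 origin x y
fault-free-at-origin {x} x~y with adj⇒neighbour x~y
... | d , refl = fault-free-along d x

lemma3p2 : (v : Vertex) → (e : Edge) →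
    Σ (Cycle 14) (λ C → AvoidsVertex C v × AvoidsEdge C (proj₁ (proj₁ e)) (proj₂ (proj₁ e)))
lemma3p2 v ((x , y) , x~y) =
  subst (λ u → FaultFreeCycle 14 u x y) (reach-origin v)
        (transport (reach v) (fault-free-at-origin (from-adj (reach v) x~y)))
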